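{- Let $\mathcal{G}$ be a temporal graph with TIM width $\mathsf{tim}(\mathcal{G})$, and let $\mathcal{S}_{\mathsf{tim}}(\mathcal{G})$ be its TIM encoding (built from a TIM decomposition of width $\mathsf{tim}(\mathcal{G})$). Then $\mathsf{tw}\big(\mathrm{Gf}(\mathcal{S}_{\mathsf{tim}}(\mathcal{G}))\big)\le \mathsf{tim}(\mathcal{G})^2+3\,\mathsf{tim}(\mathcal{G})-1$, and in particular $\mathsf{tw}\big(\mathrm{Gf}(\mathcal{S}_{\mathsf{tim}}(\mathcal{G}))\big)\in\mathcal{O}(\mathsf{tim}(\mathcal{G})^2)$.
   Context: A temporal graph $\mathcal{G}=(V,E,\lambda)$ consists of a static graph $(V,E)$ and a labelling $\lambda$ assigning each edge a nonempty finite set of time steps in $\mathbb{N}_{\ge1}$; temporal edges are pairs $(e,t)$ with $t\in\lambda(e)$, forming the set $\mathcal{E}$; the lifetime $\Lambda$ is the largest label. A TIM decomposition of $\mathcal{G}$ is a triple $(T,\{\Pi_i\}_{i\in V(T)},\tau)$ with $T$ a directed tree, bags $\Pi_i\subseteq V$, and $\tau:V(T)\to[\Lambda]$, such that (i) for every $v\in V$ and $t\in[\Lambda]$ there is a unique $i$ with $\tau(i)=t$ and $v\in\Pi_i$; (ii) for every temporal edge $(uv,t)$ there is an $i$ with $\tau(i)=t$ and $u,v\in\Pi_i$; (iii) $E(T)=\{(i,j):\Pi_i\cap\Pi_j\neq\emptyset,\ \tau(i)=\tau(j)+1\}$. Its width is $\max_i|\Pi_i|$, and $\mathsf{tim}(\mathcal{G})$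 is the minimum width of a TIM decomposition. The TIM encoding with respect to $(T,\{\Pi_i\},\tau)$ has universe $V\cup\mathcal{E}\cup\{\Pi_i:i\in V(T)\}$ (one element per bag), unary predicates for the three sorts, and binary relations: $\mathsf{inc}((uv,t),x)$ iff $x\in\{u,v\}$; $\mathsf{bag}(v,\Pi_i)$ iff $v\in\Pi_i$; $\mathsf{pres}((uv,t),\Pi_i)$ iff $\tau(i)=t$ and $u,v\in\Pi_i$; $\mathsf{next}(\Pi_i,\Pi_j)$ iff $\tau(j)=\tau(i)+1$ and $i,j$ are adjacent in $T$. The Gaifman graph $\mathrm{Gf}(\mathcal{S})$ of a relational structure $\mathcal{S}$ with universe $U$ is the simple undirected graph on $U$ in which distinct $a,b$ are adjacent iff they occur together in some tuple of some relation of arity at least 2. $\mathsf{tw}$ denotes treewidth. -}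

module Defs where

open import Data.Nat using (ℕ; zero; suc; _+_; _*_; _∸_; _≤_)
open import Data.Fin using (Fin; toℕ; inject₁; fromℕ) renaming (zero to fzero; suc to fsuc)
open import Data.Fin.Subset using (Subset; ∣_∣) renaming (_∈_ to _∈ₛ_)
open import Data.Product using (Σ; Σ-syntax; ∃; ∃-syntax; _×_; _,_)
open import Data.Sum using (_⊎_; inj₁; inj₂)
open import Data.Empty using (⊥)
open import Data.List using (List; length)
open import Data.List.Membership.Propositional using (_∈_)
open import Data.Unit using (⊤)
open import Data.Bool using (Bool; true)
open import Relation.Binary.PropositionalEquality using (_≡_; _≢_)
open import Function.Definitions using (Injective)

data Walk {k : ℕ} (R : Fin k → Fin k → Set) (P : Fin k → Set) : Fin k → Fin k → Set where
  here : ∀ {i} → P i → Walk R P i i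
  step : ∀ {i j l} → P i → R i j → Walk R P j l → Walk R P i l

record Cycle {k : ℕ} (R : Fin k → Fin k → Set) : Set where
  field
    m      : ℕ
    node   : Fin (suc (suc (suc m))) → Fin k
    inj    : Injective _≡_ _≡_ node
    steps  : ∀ (i : Fin (suc (suc m))) → R (node (inject₁ i)) (node (fsuc i))
    close  : R (node (fromℕ (suc (suc m)))) (node fzero)

record IsTree {k : ℕ} (R : Fin k → Fin k → Set) : Set where
  field
    symm      : ∀ i j → R i j → R j i
    irrefl    : ∀ i → R i i → ⊥
    connected : ∀ i j → Walk R (λ _ → ⊤) i j
    acyclic   : Cycle R → ⊥

record TreeDecomposition (U : Set) (adj : U → U → Set) : Set₁ where
  field
    k       : ℕ
    tadj    : Fin k → Fin k → Set
    isTree  : IsTree tadj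
    bag     : Fin k → List U
    coverV  : ∀ u → ∃[ i ] (u ∈ bag i)
    coverE  : ∀ a b → adj a b → ∃[ i ] (a ∈ bag i × b ∈ bag i)
    connV   : ∀ u i j → u ∈ bag i → u ∈ bag j → Walk tadj (λ l → u ∈ bag l) i j

TreewidthAtMost : (U : Set) (adj : U → U → Set) → ℕ → Set₁
TreewidthAtMost U adj w =
  Σ[ D ∈ TreeDecomposition U adj ] (∀ i → length (TreeDecomposition.bag D i) ≤ suc w)

-- Temporal graphs
-- Vertices Fin n; static (simple) edges Fin m with endpoints; labels are
-- subsets of [Λ] where t : Fin Λ stands for the time step toℕ t + 1.

record TemporalGraph : Set where
  field
    n        : ℕ
    m        : ℕ
    src      : Fin m → Fin n
    tgt      : Fin m → Fin n
    loopless : ∀ e → src e ≢ tgt e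
    simple   : ∀ e e' → (src e ≡ src e' × tgt e ≡ tgt e') ⊎ (src e ≡ tgt e' × tgt e ≡ src e')
                      → e ≡ e'
    Λ        : ℕ
    lab      : Fin m → Fin Λ → Bool
    labNonempty : ∀ e → ∃[ t ] (lab e t ≡ true)
    -- Λ is the largest label (Λ = 0 only when there are no edges)
    lifetime : ∀ l → Λ ≡ suc l → ∃[ e ] ∃[ t ] (toℕ t ≡ l × lab e t ≡ true)

module _ (G : TemporalGraph) where
  open TemporalGraph G

  TEdge : Set
  TEdge = Σ[ e ∈ Fin m ] Σ[ t ∈ Fin Λ ] (lab e t ≡ true)

  tEdgeEdge : TEdge → Fin m
  tEdgeEdge (e , _ , _) = e

  tEdgeTime : TEdge → Fin Λ
  tEdgeTime (_ , t , _) = t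

  record TIMData : Set where
    field
      k   : ℕ
      Π   : Fin k → Subset n
      τ   : Fin k → Fin Λ

  module _ (D : TIMData) where
    open TIMData D

    TArc : Fin k → Fin k → Set
    TArc i j = (∃[ v ] (v ∈ₛ Π i × v ∈ₛ Π j)) × (toℕ (τ i) ≡ suc (toℕ (τ j)))

    TAdj : Fin k → Fin k → Set
    TAdj i j = TArc i j ⊎ TArc j i

    record IsTIMDecomposition : Set where
      field
        treeT    : IsTree TAdj
        uniqueVT : ∀ (v : Fin n) (t : Fin Λ) →
                     Σ[ i ∈ Fin k ] ((τ i ≡ t × v ∈ₛ Π i) ×
                                     (∀ j → τ j ≡ t → v ∈ₛ Π j → j ≡ i))
        coverTE  : ∀ (x : TEdge) → Σ[ i ∈ Fin k ]
                     (τ i ≡ tEdgeTime x × src (tEdgeEdge x) ∈ₛ Π i × tgt (tEdgeEdge x) ∈ₛ Π i)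

    WidthAtMost : ℕ → Set
    WidthAtMost w = ∀ i → ∣ Π i ∣ ≤ w

    EncU : Set
    EncU = Fin n ⊎ (TEdge ⊎ Fin k)

    vtx : Fin n → EncU
    vtx v = inj₁ v

    tedge : TEdge → EncU
    tedge x = inj₂ (inj₁ x)

    bagE : Fin k → EncU
    bagE i = inj₂ (inj₂ i)

    data EncTuple : EncU → EncU → Set where
      inc  : ∀ (x : TEdge) (w : Fin n) →
               (w ≡ src (tEdgeEdge x) ⊎ w ≡ tgt (tEdgeEdge x)) → EncTuple (tedge x) (vtx w)
      bagR : ∀ (v : Fin n) (i : Fin k) → v ∈ₛ Π i → EncTuple (vtx v) (bagE i)
      pres : ∀ (x : TEdge) (i : Fin k) → τ i ≡ tEdgeTime x →
               src (tEdgeEdge x) ∈ₛ Π i → tgt (tEdgeEdge x) ∈ₛ Π i →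
               EncTuple (tedge x) (bagE i)
      next : ∀ (i j : Fin k) → toℕ (τ j) ≡ suc (toℕ (τ i)) → TAdj i j →
               EncTuple (bagE i) (bagE j)

    GfAdj : EncU → EncU → Set
    GfAdj a b = a ≢ b × (EncTuple a b ⊎ EncTuple b a)

module Submission where

-- The tree of the TIM decomposition itself carries a tree decomposition of the
-- Gaifman graph.  The bag of node i holds the element Π_i, the vertices of Π_i,
-- the temporal edges present at i, and the T-neighbours of i.  Since a vertex
-- lies in exactly one bag per time step, i has at most |Π_i| neighbours at each
-- of the two adjacent times; the temporal edges present at i share one time
-- step and have simple, loopless underlying edges, so they inject into the
-- ordered pairs of distinct vertices of Π_i.  Hence a bag has at most
-- 1 + w + (w² - 1) + 2w = w² + 3w elements.  The nodes holding a vertex form a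
-- path through consecutive times, a temporal edge lies in a single bag, and an
-- element Π_j lies in the star around j.  With an empty lifetime the encoding
-- has no tuples, and singleton bags on a star suffice.

open import Defs
open import Data.Nat using (ℕ; zero; suc; _+_; _*_; _∸_; _≤_; _<_; z≤n; s≤s)
open import Data.Nat.Properties
open import Data.Nat.Solver using (module +-*-Solver)
open import Data.Fin using (Fin; toℕ; fromℕ<) renaming (zero to fzero; suc to fsuc)
open import Data.Fin.Properties using (injective⇒≤; toℕ-injective; toℕ<n; toℕ-fromℕ<; any?; ¬Fin0)
open import Data.Fin.Subset using (Subset; ∣_∣) renaming (_∈_ to _∈ₛ_)
open import Data.Fin.Subset.Properties using (_∈?_)
open import Data.Vec using ([]; _∷_; here; there)
open import Data.Bool using (true; false)
import Data.Bool.Properties as Bool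
open import Data.Product using (∃-syntax; _×_; _,_; proj₁; proj₂)
open import Data.Product.Properties using (×-≡,≡←≡)
open import Data.Sum using (_⊎_; inj₁; inj₂; swap)
open import Data.Sum.Properties using (inj₁-injective)
open import Data.Empty using (⊥; ⊥-elim)
open import Data.Unit using (⊤; tt)
open import Data.List using (List; []; _∷_; length; map; _++_; lookup; cartesianProduct; drop; filter; allFin)
open import Data.List.Properties using (length-map; length-++; length-drop)
open import Data.List.Membership.Propositional using (_∈_; mapWith∈)
open import Data.List.Membership.Propositional.Properties
open import Data.List.Membership.Setoid.Properties using (length-mapWith∈)
open import Data.List.Relation.Unary.Any using (here; there; index)
open import Data.List.Relation.Unary.Any.Properties using (lookup-index; mapWith∈⁺; mapWith∈⁻)
import Data.List.Relation.Unary.All as All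
open import Data.List.Relation.Unary.AllPairs using (_∷_)
open import Data.List.Relation.Unary.Unique.Propositional using (Unique)
open import Data.List.Relation.Unary.Unique.Propositional.Properties using (filter⁺; allFin⁺)
open import Relation.Nullary using (Dec; yes; no; ¬_)
open import Relation.Nullary.Decidable using (_×-dec_)
open import Relation.Binary.PropositionalEquality
open import Axiom.UniquenessOfIdentityProofs using (module Decidable⇒UIP)
open import Function.Base using (_∘_; case_of_)
open import Function.Bundles using (_⇔_; mk⇔; Equivalence)
open import Function.Construct.Composition using (_⇔-∘_)
open import Function.Definitions using (Injective)

open Equivalence using (to; from)
open Decidable⇒UIP Bool._≟_ using () renaming (≡-irrelevant to Bool-≡-irrelevant)

module _ {k : ℕ} {R : Fin k → Fin k → Set} where

  walk-start : ∀ {P i j} → Walk R P i j → P i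
  walk-start (here p)     = p
  walk-start (step p _ _) = p

  infixr 5 _++ʷ_
  _++ʷ_ : ∀ {P i j l} → Walk R P i j → Walk R P j l → Walk R P i l
  here _     ++ʷ w′ = w′
  step p r w ++ʷ w′ = step p r (w ++ʷ w′)

  reverseʷ : (∀ i j → R i j → R j i) → ∀ {P i j} → Walk R P i j → Walk R P j i
  reverseʷ sym-R (here p)     = here p
  reverseʷ sym-R (step p r w) = reverseʷ sym-R w ++ʷ step (walk-start w) (sym-R _ _ r) (here p)

  mapʷ : ∀ {P Q : Fin k → Set} → (∀ {i} → P i → Q i) → ∀ {i j} → Walk R P i j → Walk R Q i j
  mapʷ f (here p)     = here (f p)
  mapʷ f (step p r w) = step (f p) r (mapʷ f w)

IsHub : ∀ {n} → Fin n → Set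
IsHub i = toℕ i ≡ 0

StarAdj : ∀ {n} → Fin n → Fin n → Set
StarAdj i j = (IsHub i ⊎ IsHub j) × i ≢ j

hub-unique : ∀ {n} {i j : Fin n} → IsHub i → IsHub j → i ≡ j
hub-unique i⋆ j⋆ = toℕ-injective (trans i⋆ (sym j⋆))

StarAdj-sym : ∀ {n} (i j : Fin n) → StarAdj i j → StarAdj j i
StarAdj-sym _ _ (hub , i≢j) = swap hub , i≢j ∘ sym

star-connected : ∀ {n} (i j : Fin n) → Walk StarAdj (λ _ → ⊤) i j
star-connected {zero}  ()
star-connected {suc _} i j = toHub i ++ʷ reverseʷ StarAdj-sym (toHub j)
  where
  toHub : ∀ {n} (i : Fin (suc n)) → Walk StarAdj (λ _ → ⊤) i fzero
  toHub fzero    = here tt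
  toHub (fsuc i) = step tt (inj₂ refl , λ ()) (here tt)

no-star-path₃ : ∀ {n} {a b c d : Fin n} →
  StarAdj a b → StarAdj b c → StarAdj c d → a ≢ c → b ≢ d → ⊥
no-star-path₃ (inj₂ b⋆ , _) (_ , b≢c)       c~d _   b≢d = centred b⋆ b≢c c~d b≢d
  where
  centred : ∀ {n} {b c d : Fin n} → IsHub b → b ≢ c → StarAdj c d → b ≢ d → ⊥
  centred b⋆ b≢c (inj₁ c⋆ , _) _   = b≢c (hub-unique b⋆ c⋆)
  centred b⋆ _   (inj₂ d⋆ , _) b≢d = b≢d (hub-unique b⋆ d⋆)
no-star-path₃ (inj₁ _  , _) (inj₁ b⋆ , b≢c) (inj₁ c⋆ , _) _ _ = b≢c (hub-unique b⋆ c⋆)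
no-star-path₃ (inj₁ _  , _) (inj₁ b⋆ , _)   (inj₂ d⋆ , _) _ b≢d = b≢d (hub-unique b⋆ d⋆)
no-star-path₃ (inj₁ a⋆ , _) (inj₂ c⋆ , _)   _             a≢c _ = a≢c (hub-unique a⋆ c⋆)

-- Every cycle has three consecutive edges a b, b c, c d with a ≢ c and b ≢ d.
star-acyclic : ∀ {n} → Cycle (StarAdj {n}) → ⊥
star-acyclic record { m = zero ; inj = inj ; steps = steps ; close = close } =
  no-star-path₃ (steps fzero) (steps (fsuc fzero)) close
    (λ eq → case inj eq of λ ()) (λ eq → case inj eq of λ ())
star-acyclic record { m = suc _ ; inj = inj ; steps = steps } =
  no-star-path₃ (steps fzero) (steps (fsuc fzero)) (steps (fsuc (fsuc fzero)))
    (λ eq → case inj eq of λ ()) (λ eq → case inj eq of λ ())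

star-isTree : ∀ n → IsTree (StarAdj {n})
star-isTree n = record
  { symm = StarAdj-sym ; irrefl = λ _ i~i → proj₂ i~i refl
  ; connected = star-connected ; acyclic = star-acyclic }

edgeless-treewidth : ∀ {U : Set} {adj : U → U → Set} {n} (f : Fin n → U) →
  Injective _≡_ _≡_ f → (∀ u → ∃[ v ] f v ≡ u) → (∀ a b → ¬ adj a b) →
  ∀ w → TreewidthAtMost U adj w
edgeless-treewidth {U} {adj} {n} f f-inj f-surj edgeless _ = decomposition , λ _ → s≤s z≤n
  where
  connected : ∀ u i j → u ∈ f i ∷ [] → u ∈ f j ∷ [] → Walk StarAdj (λ l → u ∈ f l ∷ []) i j
  connected _ i j (here refl) (here fi≡fj) with f-inj fi≡fj
  ... | refl = here (here refl)

  decomposition : TreeDecomposition U adj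
  decomposition = record
    { k = n ; tadj = StarAdj ; isTree = star-isTree n ; bag = λ v → f v ∷ []
    ; coverV = λ u → proj₁ (f-surj u) , here (sym (proj₂ (f-surj u)))
    ; coverE = λ a b a~b → ⊥-elim (edgeless a b a~b)
    ; connV = connected }

module _ {A B : Set} where

  infixr 5 _⊎ₗ_
  _⊎ₗ_ : List A → List B → List (A ⊎ B)
  xs ⊎ₗ ys = map inj₁ xs ++ map inj₂ ys

  length-⊎ₗ : ∀ (xs : List A) (ys : List B) → length (xs ⊎ₗ ys) ≡ length xs + length ys
  length-⊎ₗ xs ys = trans (length-++ (map inj₁ xs)) (cong₂ _+_ (length-map inj₁ xs) (length-map inj₂ ys))

  inj₁-∈-⊎ₗ⇔ : ∀ {x} {xs : List A} {ys : List B} → inj₁ x ∈ xs ⊎ₗ ys ⇔ x ∈ xs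
  inj₁-∈-⊎ₗ⇔ {x} {xs} {ys} = mk⇔ to′ (∈-++⁺ˡ ∘ ∈-map⁺ inj₁)
    where
    to′ : inj₁ x ∈ xs ⊎ₗ ys → x ∈ xs
    to′ x∈ with ∈-++⁻ (map inj₁ xs) x∈
    ... | inj₁ x∈l with ∈-map⁻ inj₁ x∈l
    ...   | _ , x∈xs , refl = x∈xs
    to′ x∈ | inj₂ x∈r with ∈-map⁻ inj₂ x∈r
    ...   | _ , _ , ()

  inj₂-∈-⊎ₗ⇔ : ∀ {y} {xs : List A} {ys : List B} → inj₂ y ∈ xs ⊎ₗ ys ⇔ y ∈ ys
  inj₂-∈-⊎ₗ⇔ {y} {xs} {ys} = mk⇔ to′ (∈-++⁺ʳ (map inj₁ xs) ∘ ∈-map⁺ inj₂)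
    where
    to′ : inj₂ y ∈ xs ⊎ₗ ys → y ∈ ys
    to′ y∈ with ∈-++⁻ (map inj₁ xs) y∈
    ... | inj₁ y∈l with ∈-map⁻ inj₁ y∈l
    ...   | _ , _ , ()
    to′ y∈ | inj₂ y∈r with ∈-map⁻ inj₂ y∈r
    ...   | _ , y∈ys , refl = y∈ys

  length-cartesianProduct : ∀ (xs : List A) (ys : List B) →
    length (cartesianProduct xs ys) ≡ length xs * length ys
  length-cartesianProduct []       ys = refl
  length-cartesianProduct (x ∷ xs) ys =
    trans (length-++ (map (x ,_) ys)) (cong₂ _+_ (length-map (x ,_) ys) (length-cartesianProduct xs ys))

  Unique-lookup-injective : ∀ {xs : List A} → Unique xs → ∀ {i j} → lookup xs i ≡ lookup xs j → i ≡ j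
  Unique-lookup-injective {_ ∷ _} (_ ∷ _)     {fzero}  {fzero}  _  = refl
  Unique-lookup-injective {_ ∷ _} (x∉ ∷ _)    {fzero}  {fsuc j} eq = ⊥-elim (All.lookup x∉ (∈-lookup j) eq)
  Unique-lookup-injective {_ ∷ _} (x∉ ∷ _)    {fsuc i} {fzero}  eq = ⊥-elim (All.lookup x∉ (∈-lookup i) (sym eq))
  Unique-lookup-injective {_ ∷ _} (_ ∷ uniq)  {fsuc i} {fsuc j} eq = cong fsuc (Unique-lookup-injective uniq eq)

  length-≤-of-injection : ∀ {xs : List A} {ys : List B} (R : A → B → Set) → Unique xs →
    (∀ {x} → x ∈ xs → ∃[ y ] (y ∈ ys × R x y)) →
    (∀ {x x′ y} → x ∈ xs → x′ ∈ xs → R x y → R x′ y → x ≡ x′) →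
    length xs ≤ length ys
  length-≤-of-injection {xs} {ys} R uniq image R-injective = injective⇒≤ {f = position} position-injective
    where
    position : Fin (length xs) → Fin (length ys)
    position i = index (proj₁ (proj₂ (image (∈-lookup {xs = xs} i))))

    position-injective : Injective _≡_ _≡_ position
    position-injective {i} {j} eq with image (∈-lookup {xs = xs} i) | image (∈-lookup {xs = xs} j)
    ... | y , y∈ , Rxy | y′ , y′∈ , Rx′y′ =
      Unique-lookup-injective uniq (R-injective (∈-lookup i) (∈-lookup j) Rxy (subst (R _) (sym y≡y′) Rx′y′))
      where
      y≡y′ : y ≡ y′
      y≡y′ = trans (lookup-index y∈) (trans (cong (lookup ys) eq) (sym (lookup-index y′∈)))

-- Drops the pair (x₀ , x₀) of the head x₀, so every pair of distinct members survives.
squareMinusHead : ∀ {A : Set} → List A → List (A × A)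
squareMinusHead xs = drop 1 (cartesianProduct xs xs)

length-squareMinusHead : ∀ {A : Set} (xs : List A) →
  length (squareMinusHead xs) ≡ length xs * length xs ∸ 1
length-squareMinusHead xs =
  trans (length-drop 1 (cartesianProduct xs xs)) (cong (_∸ 1) (length-cartesianProduct xs xs))

∈-squareMinusHead : ∀ {A : Set} {x y : A} {xs : List A} →
  x ∈ xs → y ∈ xs → x ≢ y → (x , y) ∈ squareMinusHead xs
∈-squareMinusHead              (here refl) (here refl)  x≢y = ⊥-elim (x≢y refl)
∈-squareMinusHead {xs = a ∷ l} (here refl) (there y∈l)  _   = ∈-++⁺ˡ (∈-map⁺ (a ,_) y∈l)
∈-squareMinusHead {xs = a ∷ l} (there x∈l) y∈xs         _   =
  ∈-++⁺ʳ (map (a ,_) l) (∈-cartesianProduct⁺ x∈l y∈xs)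

members : ∀ {n} → Subset n → List (Fin n)
members []          = []
members (true ∷ p)  = fzero ∷ map fsuc (members p)
members (false ∷ p) = map fsuc (members p)

length-members : ∀ {n} (p : Subset n) → length (members p) ≡ ∣ p ∣
length-members []          = refl
length-members (true ∷ p)  = cong suc (trans (length-map fsuc (members p)) (length-members p))
length-members (false ∷ p) = trans (length-map fsuc (members p)) (length-members p)

∈-members⇔ : ∀ {n} {x : Fin n} {p : Subset n} → x ∈ members p ⇔ x ∈ₛ p
∈-members⇔ {p = p} = mk⇔ (sound p) (complete p)
  where
  sound : ∀ {n} {x : Fin n} (p : Subset n) → x ∈ members p → x ∈ₛ p
  sound (true ∷ p)  (here refl) = here
  sound (true ∷ p)  (there x∈)  with ∈-map⁻ fsuc x∈
  ... | _ , x∈p , refl = there (sound p x∈p)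
  sound (false ∷ p) x∈          with ∈-map⁻ fsuc x∈
  ... | _ , x∈p , refl = there (sound p x∈p)

  complete : ∀ {n} {x : Fin n} (p : Subset n) → x ∈ₛ p → x ∈ members p
  complete (true ∷ p)  here      = here refl
  complete (true ∷ p)  (there x) = there (∈-map⁺ fsuc (complete p x))
  complete (false ∷ p) (there x) = ∈-map⁺ fsuc (complete p x)

-- At c = 0 both sides are 1, the truncated subtraction absorbing the empty pair list.
bagSize-identity : ∀ c → c + ((c * c ∸ 1) + suc (c + c)) ≡ suc (c * c + 3 * c ∸ 1)
bagSize-identity zero    = refl
bagSize-identity (suc c) = solve 1
  (λ c → (con 1 :+ c) :+ ((c :+ c :* (con 1 :+ c)) :+ (con 1 :+ ((con 1 :+ c) :+ (con 1 :+ c))))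
      := con 1 :+ ((c :+ c :* (con 1 :+ c)) :+ con 3 :* (con 1 :+ c))) refl c
  where open +-*-Solver

bagSize-mono : ∀ {c w} → c ≤ w → c * c + 3 * c ∸ 1 ≤ w * w + 3 * w ∸ 1
bagSize-mono c≤w = ∸-monoˡ-≤ 1 (+-mono-≤ (*-mono-≤ c≤w c≤w) (*-monoʳ-≤ 3 c≤w))

module TIMEncoding (G : TemporalGraph) (D : TIMData G) (isD : IsTIMDecomposition G D) where
  open TemporalGraph G
  open TIMData D
  open IsTIMDecomposition isD

  sameTime⇒sameNode : ∀ {v i j} → v ∈ₛ Π i → v ∈ₛ Π j → τ i ≡ τ j → i ≡ j
  sameTime⇒sameNode {v} {i} {j} v∈i v∈j τi≡τj with uniqueVT v (τ i)
  ... | _ , _ , unique = trans (unique i refl v∈i) (sym (unique j (sym τi≡τj) v∈j))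

  TAdj-sym : ∀ i j → TAdj G D i j → TAdj G D j i
  TAdj-sym _ _ = swap

  -- The node holding v at each intermediate time is T-adjacent to the previous one.
  vertexWalk-forward : ∀ d {v i j} → v ∈ₛ Π i → v ∈ₛ Π j → toℕ (τ j) ≡ d + toℕ (τ i) →
    Walk (TAdj G D) (λ l → v ∈ₛ Π l) i j
  vertexWalk-forward zero    {i = i} v∈i v∈j τj≡τi =
    subst (Walk _ _ i) (sameTime⇒sameNode v∈i v∈j (toℕ-injective (sym τj≡τi))) (here v∈i)
  vertexWalk-forward (suc d) {v} {i} {j} v∈i v∈j τj≡ with uniqueVT v (fromℕ< s<Λ)
    where
    s<Λ : d + toℕ (τ i) < Λ
    s<Λ = ≤-trans (n≤1+n _) (subst (_< Λ) τj≡ (toℕ<n (τ j)))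
  ... | j′ , (τj′≡ , v∈j′) , _ =
    vertexWalk-forward d v∈i v∈j′ τj′≡d+τi ++ʷ step v∈j′ (inj₂ ((v , v∈j , v∈j′) , τj≡1+τj′)) (here v∈j)
    where
    τj′≡d+τi : toℕ (τ j′) ≡ d + toℕ (τ i)
    τj′≡d+τi = trans (cong toℕ τj′≡) (toℕ-fromℕ< _)
    τj≡1+τj′ : toℕ (τ j) ≡ suc (toℕ (τ j′))
    τj≡1+τj′ = trans τj≡ (cong suc (sym τj′≡d+τi))

  vertexWalk : ∀ {v i j} → v ∈ₛ Π i → v ∈ₛ Π j → Walk (TAdj G D) (λ l → v ∈ₛ Π l) i j
  vertexWalk {i = i} {j} v∈i v∈j with ≤-total (toℕ (τ i)) (toℕ (τ j))
  ... | inj₁ τi≤τj = vertexWalk-forward _ v∈i v∈j (sym (m∸n+n≡m τi≤τj))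
  ... | inj₂ τj≤τi = reverseʷ TAdj-sym (vertexWalk-forward _ v∈j v∈i (sym (m∸n+n≡m τj≤τi)))

  sharingNodesAtOneTime-≤ : ∀ {i} {js : List (Fin k)} → Unique js →
    (∀ {j} → j ∈ js → ∃[ v ] (v ∈ₛ Π i × v ∈ₛ Π j)) →
    (∀ {j j′} → j ∈ js → j′ ∈ js → τ j ≡ τ j′) →
    length js ≤ ∣ Π i ∣
  sharingNodesAtOneTime-≤ {i} {js} uniq shares sameTime =
    subst (length js ≤_) (length-members (Π i))
      (length-≤-of-injection (λ j v → v ∈ₛ Π j) uniq
        (λ j∈ → let v , v∈i , v∈j = shares j∈ in v , from ∈-members⇔ v∈i , v∈j)
        (λ j∈ j′∈ v∈j v∈j′ → sameTime⇒sameNode v∈j v∈j′ (sameTime j∈ j′∈)))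

  TArc? : ∀ i j → Dec (TArc G D i j)
  TArc? i j = any? (λ v → (v ∈? Π i) ×-dec (v ∈? Π j)) ×-dec (toℕ (τ i) ≟ suc (toℕ (τ j)))

  earlierNeighbours laterNeighbours : Fin k → List (Fin k)
  earlierNeighbours i = filter (TArc? i) (allFin k)
  laterNeighbours   i = filter (λ j → TArc? j i) (allFin k)

  earlierNeighbours-≤ : ∀ i → length (earlierNeighbours i) ≤ ∣ Π i ∣
  earlierNeighbours-≤ i = sharingNodesAtOneTime-≤ (filter⁺ (TArc? i) (allFin⁺ k))
    (proj₁ ∘ arc)
    (λ j∈ j′∈ → toℕ-injective (suc-injective (trans (sym (proj₂ (arc j∈))) (proj₂ (arc j′∈)))))
    where
    arc : ∀ {j} → j ∈ earlierNeighbours i → TArc G D i j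
    arc = proj₂ ∘ ∈-filter⁻ (TArc? i) {xs = allFin k}

  laterNeighbours-≤ : ∀ i → length (laterNeighbours i) ≤ ∣ Π i ∣
  laterNeighbours-≤ i = sharingNodesAtOneTime-≤ (filter⁺ (λ j → TArc? j i) (allFin⁺ k))
    (λ j∈ → let v , v∈j , v∈i = proj₁ (arc j∈) in v , v∈i , v∈j)
    (λ j∈ j′∈ → toℕ-injective (trans (proj₂ (arc j∈)) (sym (proj₂ (arc j′∈)))))
    where
    arc : ∀ {j} → j ∈ laterNeighbours i → TArc G D j i
    arc = proj₂ ∘ ∈-filter⁻ (λ j → TArc? j i) {xs = allFin k}

  neighbourhood : Fin k → List (Fin k)
  neighbourhood i = i ∷ earlierNeighbours i ++ laterNeighbours i

  ∈-neighbourhood⇔ : ∀ {i j} → j ∈ neighbourhood i ⇔ (j ≡ i ⊎ TAdj G D i j)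
  ∈-neighbourhood⇔ {i} {j} = mk⇔ to′ from′
    where
    to′ : j ∈ neighbourhood i → j ≡ i ⊎ TAdj G D i j
    to′ (here j≡i) = inj₁ j≡i
    to′ (there j∈) with ∈-++⁻ (earlierNeighbours i) j∈
    ... | inj₁ j∈e = inj₂ (inj₁ (proj₂ (∈-filter⁻ (TArc? i) {xs = allFin k} j∈e)))
    ... | inj₂ j∈l = inj₂ (inj₂ (proj₂ (∈-filter⁻ (λ j → TArc? j i) {xs = allFin k} j∈l)))

    from′ : j ≡ i ⊎ TAdj G D i j → j ∈ neighbourhood i
    from′ (inj₁ j≡i)       = here j≡i
    from′ (inj₂ (inj₁ ij)) = there (∈-++⁺ˡ (∈-filter⁺ (TArc? i) (∈-allFin j) ij))
    from′ (inj₂ (inj₂ ji)) =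
      there (∈-++⁺ʳ (earlierNeighbours i) (∈-filter⁺ (λ j → TArc? j i) (∈-allFin j) ji))

  PresentStatic : Fin k → Fin m → Set
  PresentStatic i e = lab e (τ i) ≡ true × src e ∈ₛ Π i × tgt e ∈ₛ Π i

  PresentStatic? : ∀ i e → Dec (PresentStatic i e)
  PresentStatic? i e = (lab e (τ i) Bool.≟ true) ×-dec ((src e ∈? Π i) ×-dec (tgt e ∈? Π i))

  presentStatic : Fin k → List (Fin m)
  presentStatic i = filter (PresentStatic? i) (allFin m)

  presentStatic-≤ : ∀ i → length (presentStatic i) ≤ ∣ Π i ∣ * ∣ Π i ∣ ∸ 1
  presentStatic-≤ i =
    subst (length (presentStatic i) ≤_)
      (trans (length-squareMinusHead (members (Π i))) (cong (λ c → c * c ∸ 1) (length-members (Π i))))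
      (length-≤-of-injection (λ e uv → (src e , tgt e) ≡ uv) (filter⁺ (PresentStatic? i) (allFin⁺ m))
        endpoints (λ _ _ → endpoints-injective))
    where
    endpoints : ∀ {e} → e ∈ presentStatic i →
      ∃[ uv ] (uv ∈ squareMinusHead (members (Π i)) × (src e , tgt e) ≡ uv)
    endpoints {e} e∈ with proj₂ (∈-filter⁻ (PresentStatic? i) {xs = allFin m} e∈)
    ... | _ , s∈ , t∈ = _ , ∈-squareMinusHead (from ∈-members⇔ s∈) (from ∈-members⇔ t∈) (loopless e) , refl

    endpoints-injective : ∀ {e e′ uv} → (src e , tgt e) ≡ uv → (src e′ , tgt e′) ≡ uv → e ≡ e′
    endpoints-injective refl eq = simple _ _ (inj₁ (×-≡,≡←≡ (sym eq)))

  PresentIn : TEdge G → Fin k → Set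
  PresentIn x i = τ i ≡ tEdgeTime G x × src (tEdgeEdge G x) ∈ₛ Π i × tgt (tEdgeEdge G x) ∈ₛ Π i

  presentIn-unique : ∀ {x i j} → PresentIn x i → PresentIn x j → i ≡ j
  presentIn-unique (τi≡ , s∈i , _) (τj≡ , s∈j , _) = sameTime⇒sameNode s∈i s∈j (trans τi≡ (sym τj≡))

  presentEdges : Fin k → List (TEdge G)
  presentEdges i = mapWith∈ (presentStatic i)
    (λ {e} e∈ → e , τ i , proj₁ (proj₂ (∈-filter⁻ (PresentStatic? i) {xs = allFin m} e∈)))

  ∈-presentEdges⇔ : ∀ {x i} → x ∈ presentEdges i ⇔ PresentIn x i
  ∈-presentEdges⇔ {x} {i} = mk⇔ to′ from′
    where
    to′ : x ∈ presentEdges i → PresentIn x i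
    to′ x∈ with mapWith∈⁻ (presentStatic i) _ x∈
    ... | e , e∈ , refl with proj₂ (∈-filter⁻ (PresentStatic? i) {xs = allFin m} e∈)
    ...   | _ , s∈ , t∈ = refl , s∈ , t∈

    from′ : ∀ {x} → PresentIn x i → x ∈ presentEdges i
    from′ {e , _ , p} (refl , s∈ , t∈) =
      mapWith∈⁺ _ (e , e∈ , cong (λ q → e , τ i , q) (Bool-≡-irrelevant _ _))
      where
      e∈ : e ∈ presentStatic i
      e∈ = ∈-filter⁺ (PresentStatic? i) (∈-allFin e) (p , s∈ , t∈)

  bag : Fin k → List (EncU G D)
  bag i = members (Π i) ⊎ₗ presentEdges i ⊎ₗ neighbourhood i

  vtx∈bag⇔ : ∀ {v i} → vtx G D v ∈ bag i ⇔ v ∈ₛ Π i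
  vtx∈bag⇔ {i = i} = ∈-members⇔ ⇔-∘ inj₁-∈-⊎ₗ⇔ {ys = presentEdges i ⊎ₗ neighbourhood i}

  tedge∈bag⇔ : ∀ {x i} → tedge G D x ∈ bag i ⇔ PresentIn x i
  tedge∈bag⇔ {i = i} =
    (∈-presentEdges⇔ ⇔-∘ inj₁-∈-⊎ₗ⇔ {ys = neighbourhood i}) ⇔-∘ inj₂-∈-⊎ₗ⇔ {xs = members (Π i)}

  bagE∈bag⇔ : ∀ {j i} → bagE G D j ∈ bag i ⇔ (j ≡ i ⊎ TAdj G D i j)
  bagE∈bag⇔ {i = i} =
    (∈-neighbourhood⇔ ⇔-∘ inj₂-∈-⊎ₗ⇔ {xs = presentEdges i}) ⇔-∘ inj₂-∈-⊎ₗ⇔ {xs = members (Π i)}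

  length-bag : ∀ i → length (bag i) ≡
    ∣ Π i ∣ + (length (presentStatic i) + suc (length (earlierNeighbours i) + length (laterNeighbours i)))
  length-bag i = begin
    length (bag i)
      ≡⟨ length-⊎ₗ (members (Π i)) _ ⟩
    length (members (Π i)) + length (presentEdges i ⊎ₗ neighbourhood i)
      ≡⟨ cong₂ _+_ (length-members (Π i)) (length-⊎ₗ (presentEdges i) (neighbourhood i)) ⟩
    ∣ Π i ∣ + (length (presentEdges i) + length (neighbourhood i))
      ≡⟨ cong (λ l → ∣ Π i ∣ + (l + length (neighbourhood i)))
              (length-mapWith∈ (setoid (Fin m)) (presentStatic i)) ⟩
    ∣ Π i ∣ + (length (presentStatic i) + suc (length (earlierNeighbours i ++ laterNeighbours i)))
      ≡⟨ cong (λ l → ∣ Π i ∣ + (length (presentStatic i) + suc l)) (length-++ (earlierNeighbours i)) ⟩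
    ∣ Π i ∣ + (length (presentStatic i) + suc (length (earlierNeighbours i) + length (laterNeighbours i))) ∎
    where open ≡-Reasoning

  bag-≤ : ∀ i → length (bag i) ≤ suc (∣ Π i ∣ * ∣ Π i ∣ + 3 * ∣ Π i ∣ ∸ 1)
  bag-≤ i = begin
    length (bag i)
      ≡⟨ length-bag i ⟩
    c + (length (presentStatic i) + suc (length (earlierNeighbours i) + length (laterNeighbours i)))
      ≤⟨ +-monoʳ-≤ c (+-mono-≤ (presentStatic-≤ i)
                     (s≤s (+-mono-≤ (earlierNeighbours-≤ i) (laterNeighbours-≤ i)))) ⟩
    c + ((c * c ∸ 1) + suc (c + c))
      ≡⟨ bagSize-identity c ⟩
    suc (c * c + 3 * c ∸ 1) ∎
    where
    open ≤-Reasoning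
    c = ∣ Π i ∣

  tuple-covered : ∀ {a b} → EncTuple G D a b → ∃[ i ] (a ∈ bag i × b ∈ bag i)
  tuple-covered (inc x w w-end) with coverTE x
  ... | i , x-in-i@(_ , s∈ , t∈) = i , from tedge∈bag⇔ x-in-i , from vtx∈bag⇔ (endpoint w-end)
    where
    endpoint : ∀ {w} → w ≡ src (tEdgeEdge G x) ⊎ w ≡ tgt (tEdgeEdge G x) → w ∈ₛ Π i
    endpoint (inj₁ refl) = s∈
    endpoint (inj₂ refl) = t∈
  tuple-covered (bagR v i v∈i)         = i , from vtx∈bag⇔ v∈i , from bagE∈bag⇔ (inj₁ refl)
  tuple-covered (pres x i τi≡ s∈ t∈)   = i , from tedge∈bag⇔ (τi≡ , s∈ , t∈) , from bagE∈bag⇔ (inj₁ refl)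
  tuple-covered (next i j _ i~j)       = i , from bagE∈bag⇔ (inj₁ refl) , from bagE∈bag⇔ (inj₂ i~j)

  walkTowards : ∀ {i l} → (l ≡ i ⊎ TAdj G D i l) → Walk (TAdj G D) (λ a → bagE G D l ∈ bag a) i l
  walkTowards (inj₁ refl) = here (from bagE∈bag⇔ (inj₁ refl))
  walkTowards (inj₂ i~l)  = step (from bagE∈bag⇔ (inj₂ i~l)) i~l (here (from bagE∈bag⇔ (inj₁ refl)))

  bags-connected : ∀ u i j → u ∈ bag i → u ∈ bag j → Walk (TAdj G D) (λ l → u ∈ bag l) i j
  bags-connected (inj₁ v) _ _ u∈i u∈j =
    mapʷ (from vtx∈bag⇔) (vertexWalk (to vtx∈bag⇔ u∈i) (to vtx∈bag⇔ u∈j))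
  bags-connected (inj₂ (inj₁ x)) i j u∈i u∈j
    with presentIn-unique {x} (to (tedge∈bag⇔ {i = i}) u∈i) (to (tedge∈bag⇔ {i = j}) u∈j)
  ... | refl = here u∈i
  bags-connected (inj₂ (inj₂ l)) _ _ u∈i u∈j =
    walkTowards (to bagE∈bag⇔ u∈i) ++ʷ reverseʷ TAdj-sym (walkTowards (to bagE∈bag⇔ u∈j))

  -- A vertex needs some time step at which to find its bag.
  encodingDecomposition : Fin Λ → TreeDecomposition (EncU G D) (GfAdj G D)
  encodingDecomposition t₀ = record
    { k = k ; tadj = TAdj G D ; isTree = treeT ; bag = bag
    ; coverV = covered ; coverE = edge-covered ; connV = bags-connected }
    where
    covered : ∀ u → ∃[ i ] (u ∈ bag i)
    covered (inj₁ v) with uniqueVT v t₀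
    ... | i , (_ , v∈i) , _ = i , from vtx∈bag⇔ v∈i
    covered (inj₂ (inj₁ x)) with coverTE x
    ... | i , x-in-i = i , from tedge∈bag⇔ x-in-i
    covered (inj₂ (inj₂ i)) = i , from bagE∈bag⇔ (inj₁ refl)

    edge-covered : ∀ a b → GfAdj G D a b → ∃[ i ] (a ∈ bag i × b ∈ bag i)
    edge-covered _ _ (_ , inj₁ t) = tuple-covered t
    edge-covered _ _ (_ , inj₂ t) with tuple-covered t
    ... | i , b∈ , a∈ = i , a∈ , b∈

  encodingTreewidth : Fin Λ → ∀ w → WidthAtMost G D w →
    TreewidthAtMost (EncU G D) (GfAdj G D) (w * w + 3 * w ∸ 1)
  encodingTreewidth t₀ w width =
    encodingDecomposition t₀ , λ i → ≤-trans (bag-≤ i) (s≤s (bagSize-mono (width i)))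

timelessEncoding-treewidth : ∀ G D → ¬ Fin (TemporalGraph.Λ G) →
  ∀ w → TreewidthAtMost (EncU G D) (GfAdj G D) w
timelessEncoding-treewidth G D noTime = edgeless-treewidth (vtx G D) inj₁-injective onlyVertices noTuple
  where
  onlyVertices : ∀ u → ∃[ v ] vtx G D v ≡ u
  onlyVertices (inj₁ v)        = v , refl
  onlyVertices (inj₂ (inj₁ x)) = ⊥-elim (noTime (tEdgeTime G x))
  onlyVertices (inj₂ (inj₂ i)) = ⊥-elim (noTime (TIMData.τ D i))

  timeless : ∀ {a b} → ¬ EncTuple G D a b
  timeless (inc x _ _)      = noTime (tEdgeTime G x)
  timeless (bagR _ i _)     = noTime (TIMData.τ D i)
  timeless (pres x _ _ _ _) = noTime (tEdgeTime G x)
  timeless (next i _ _ _)   = noTime (TIMData.τ D i)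

  noTuple : ∀ a b → ¬ GfAdj G D a b
  noTuple _ _ (_ , inj₁ t) = timeless t
  noTuple _ _ (_ , inj₂ t) = timeless t

Fin? : ∀ n → Dec (Fin n)
Fin? zero    = no ¬Fin0
Fin? (suc n) = yes fzero

mainTheorem4 : (G : TemporalGraph) (D : TIMData G) (w : ℕ) →
    IsTIMDecomposition G D →
    WidthAtMost G D w →
    (∀ (D' : TIMData G) → IsTIMDecomposition G D' → ∀ (w' : ℕ) → WidthAtMost G D' w' → w ≤ w') →
    TreewidthAtMost (EncU G D) (GfAdj G D) (w * w + 3 * w ∸ 1)
mainTheorem4 G D w isD width _ with Fin? (TemporalGraph.Λ G)
... | no  noTime = timelessEncoding-treewidth G D noTime _
... | yes t₀     = TIMEncoding.encodingTreewidth G D isD t₀ w width
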